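{- The Edge-compelling chromatic number of the path $P_n$ on $n$ vertices is $2$ for $n=2,3$; $3$ for $n=4,5,6$; and $4$ for $n\ge 7$.
   Context: A proper coloring partitions the vertex set into nonempty independent color classes; a rainbow committee (RC) is a set consisting of exactly one vertex of each color. A proper coloring is Edge-compelling if every RC contains at least one pair of adjacent vertices; the Edge-compelling chromatic number is the minimum number of colors in an Edge-compelling proper coloring. -}

module Defs where

open import Data.Nat using (ℕ; suc; _<_)
open import Data.Fin using (Fin; toℕ)
open import Data.Product using (Σ; ∃; ∃-syntax; _×_; _,_)
open import Data.Sum using (_⊎_)
open import Relation.Nullary using (¬_)
open import Relation.Binary.PropositionalEquality using (_≡_)
open import Level using (0ℓ)
open import Relation.Binary using (Rel)

record Graph (n : ℕ) : Set₁ where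
  field
    Adj : Rel (Fin n) 0ℓ
open Graph public

pathGraph : (n : ℕ) → Graph n
pathGraph n = record { Adj = λ i j → (toℕ j ≡ suc (toℕ i)) ⊎ (toℕ i ≡ suc (toℕ j)) }

-- A proper coloring with exactly k colors: every color class nonempty
-- (surjective coloring), and adjacent vertices get different colors.
record ProperColoring {n : ℕ} (G : Graph n) (k : ℕ) : Set where
  field
    color    : Fin n → Fin k
    nonempty : ∀ (a : Fin k) → ∃[ v ] color v ≡ a
    proper   : ∀ (u v : Fin n) → Adj G u v → ¬ (color u ≡ color v)
open ProperColoring public

RainbowCommittee : ∀ {n k} {G : Graph n} → ProperColoring G k → Set
RainbowCommittee {n} {k} c = Σ (Fin k → Fin n) λ r → ∀ (a : Fin k) → color c (r a) ≡ a

EdgeCompelling : ∀ {n k} {G : Graph n} → ProperColoring G k → Set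
EdgeCompelling {G = G} c =
  ∀ (R : RainbowCommittee c) → ∃[ a ] ∃[ b ] Adj G (Σ.proj₁ R a) (Σ.proj₁ R b)

HasECColoring : ∀ {n} → Graph n → ℕ → Set
HasECColoring G k = Σ (ProperColoring G k) EdgeCompelling

ECChromaticNumber : ∀ {n} → Graph n → ℕ → Set
ECChromaticNumber G k = HasECColoring G k × (∀ m → m < k → ¬ HasECColoring G m)

-- Lower bounds: a coloring is not edge-compelling as soon as some independent set of vertices
-- meets every color class.  With two colors the colors of P_n alternate, so vertices 0 and 3
-- form such a set once n ≥ 4.  With three colors and n ≥ 7, an exhaustive check of the proper
-- 3-colorings of the first seven vertices finds either such a triple among them, or a color
-- missing from them; in the latter case any vertex of that color lies beyond vertex 6 and,
-- together with vertices 0 and 3, forms an independent set meeting all three classes.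
-- Upper bounds: the colorings for n ≤ 6 are checked by deciding the property; for n ≥ 7 give
-- vertices 0 and 1 private colors and alternate two further colors along the rest, so every
-- rainbow committee contains the edge 01.

module Submission where

open import Defs
open import Data.Nat as ℕ using (ℕ; zero; suc; _+_; _≤_; _<_)
open import Data.Nat.Properties
  using ( m<1+n⇒m<n∨m≡n; m≤n⇒∃[o]m+o≡n; m+n≤o⇒n≤o; 1+n≰n; <-asym; ≤-reflexive; ≤-trans
        ; n≤1+n; ≰⇒>; _≤?_)
open import Data.Fin using (Fin; zero; suc; toℕ; #_; _↑ˡ_; fromℕ<; _≟_)
open import Data.Fin.Properties using (all?; any?; toℕ-↑ˡ; toℕ-fromℕ<; toℕ-injective)
open import Data.Vec.Functional using ([]; _∷_)
open import Data.Product using (∃-syntax; _×_; _,_; proj₁; proj₂)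
open import Data.Sum using (_⊎_; inj₁; inj₂)
open import Function using (_∘_)
open import Relation.Nullary using (¬_; Dec; yes; no; contradiction)
open import Relation.Nullary.Decidable
  using (True; map′; ¬?; _×-dec_; _⊎-dec_; _→-dec_; toWitness; from-yes)
open import Relation.Binary.PropositionalEquality
  using (_≡_; _≢_; _≗_; refl; sym; trans; cong; subst; subst₂)

Onto : ∀ {m k} → (Fin m → Fin k) → Set
Onto s = ∀ a → ∃[ i ] s i ≡ a

Onto-resp : ∀ {m k} {s t : Fin m → Fin k} → s ≗ t → Onto s → Onto t
Onto-resp s≗t onto a = let i , sᵢ≡a = onto a in i , trans (sym (s≗t i)) sᵢ≡a

Independent : ∀ {n m} → Graph n → (Fin m → Fin n) → Set
Independent G s = ∀ a b → ¬ Adj G (s a) (s b)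

Proper : ∀ {n k} → Graph n → (Fin n → Fin k) → Set
Proper G f = ∀ u v → Adj G u v → f u ≢ f v

independentTransversal⇒¬edgeCompelling :
  ∀ {n k m} {G : Graph n} (c : ProperColoring G k) (s : Fin m → Fin n) →
  Independent G s → Onto (color c ∘ s) → ¬ EdgeCompelling c
independentTransversal⇒¬edgeCompelling c s independent onto ec =
  let a , b , adj = ec ((λ a → s (proj₁ (onto a))) , λ a → proj₂ (onto a))
  in independent _ _ adj

dominatingSingleton⇒edgeCompelling :
  ∀ {n k} {G : Graph n} (c : ProperColoring G k) {v : Fin n} {a : Fin k} →
  (∀ w → color c w ≡ color c v → w ≡ v) → (∀ w → color c w ≡ a → Adj G v w) →
  EdgeCompelling c
dominatingSingleton⇒edgeCompelling {G = G} c {v} {a} singleton dominated (r , color-r) =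
  color c v , a ,
  subst (λ u → Adj G u (r a)) (sym (singleton _ (color-r _))) (dominated _ (color-r a))

¬coloring-zero : ∀ {n} {G : Graph (suc n)} → ¬ ProperColoring G 0
¬coloring-zero c with color c zero
... | ()

edge⇒¬coloring-one : ∀ {n} {G : Graph n} {u v} → Adj G u v → ¬ ProperColoring G 1
edge⇒¬coloring-one {u = u} {v} adj c with color c u in cu | color c v in cv
... | zero | zero = proper c u v adj (trans cu (sym cv))

¬hasEC-below-suc : ∀ {n} {G : Graph n} {k} →
  (∀ m → m < k → ¬ HasECColoring G m) → ¬ HasECColoring G k →
  ∀ m → m < suc k → ¬ HasECColoring G m
¬hasEC-below-suc below ¬k m m<1+k with m<1+n⇒m<n∨m≡n m<1+k
... | inj₁ m<k  = below m m<k
... | inj₂ refl = ¬k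

path-sym : ∀ {n} {u v : Fin n} → Adj (pathGraph n) u v → Adj (pathGraph n) v u
path-sym (inj₁ e) = inj₂ e
path-sym (inj₂ e) = inj₁ e

path-irrefl : ∀ {n} {u : Fin n} → ¬ Adj (pathGraph n) u u
path-irrefl (inj₁ e) = 1+n≰n (≤-reflexive (sym e))
path-irrefl (inj₂ e) = 1+n≰n (≤-reflexive (sym e))

path-adj-toℕ : ∀ {m n} {u v : Fin m} {u′ v′ : Fin n} →
  toℕ u ≡ toℕ u′ → toℕ v ≡ toℕ v′ → Adj (pathGraph m) u v → Adj (pathGraph n) u′ v′
path-adj-toℕ = subst₂ (λ x y → (y ≡ suc x) ⊎ (x ≡ suc y))

↑ˡ-preserves-adjacency : ∀ {m} q {i j : Fin m} →
  Adj (pathGraph m) i j → Adj (pathGraph (m + q)) (i ↑ˡ q) (j ↑ˡ q)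
↑ˡ-preserves-adjacency q {i} {j} = path-adj-toℕ (sym (toℕ-↑ˡ i q)) (sym (toℕ-↑ˡ j q))

↑ˡ-reflects-adjacency : ∀ {m} q {i j : Fin m} →
  Adj (pathGraph (m + q)) (i ↑ˡ q) (j ↑ˡ q) → Adj (pathGraph m) i j
↑ˡ-reflects-adjacency q {i} {j} = path-adj-toℕ (toℕ-↑ˡ i q) (toℕ-↑ˡ j q)

distant⇒¬adjacent : ∀ {n} {u w : Fin n} → 2 + toℕ u ≤ toℕ w → ¬ Adj (pathGraph n) u w
distant⇒¬adjacent far (inj₁ e) = 1+n≰n (subst (2 + _ ≤_) e far)
distant⇒¬adjacent far (inj₂ e) = <-asym (≤-reflexive (sym e)) (≤-trans (n≤1+n _) far)

absentFromPrefix⇒beyond : ∀ {m q k} (f : Fin (m + q) → Fin k) {x w} →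
  (∀ i → f (i ↑ˡ q) ≢ x) → f w ≡ x → m ≤ toℕ w
absentFromPrefix⇒beyond {m} {q} f {w = w} absent fw≡x with m ≤? toℕ w
... | yes m≤w = m≤w
... | no  m≰w = contradiction (trans (cong f iq≡w) fw≡x) (absent i)
  where
  i = fromℕ< (≰⇒> m≰w)
  iq≡w : i ↑ˡ q ≡ w
  iq≡w = toℕ-injective (trans (toℕ-↑ˡ i q) (toℕ-fromℕ< _))

∀-function? : ∀ {m n} {P : (Fin m → Fin n) → Set} →
              (∀ {f g} → f ≗ g → P f → P g) → (∀ f → Dec (P f)) → Dec (∀ f → P f)
∀-function? {zero} resp P? = map′ (λ p f → resp (λ ()) p) (λ h → h []) (P? [])
∀-function? {suc m} {P = P} resp P? =
  map′ (λ h f → resp (head∷tail f) (h (f zero) (f ∘ suc))) (λ h x g → h (x ∷ g))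
       (all? λ x → ∀-function? (resp ∘ ∷-cong x) (P? ∘ (x ∷_)))
  where
  head∷tail : ∀ f → (f zero ∷ f ∘ suc) ≗ f
  head∷tail f zero    = refl
  head∷tail f (suc i) = refl
  ∷-cong : ∀ x {f g : Fin m → _} → f ≗ g → (x ∷ f) ≗ (x ∷ g)
  ∷-cong x f≗g zero    = refl
  ∷-cong x f≗g (suc i) = f≗g i

adjacent? : ∀ {n} (u v : Fin n) → Dec (Adj (pathGraph n) u v)
adjacent? u v = toℕ v ℕ.≟ suc (toℕ u) ⊎-dec toℕ u ℕ.≟ suc (toℕ v)

independent? : ∀ {n m} {G : Graph n} → (∀ u v → Dec (Adj G u v)) →
               (s : Fin m → Fin n) → Dec (Independent G s)
independent? adj? s = all? λ a → all? λ b → ¬? (adj? (s a) (s b))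

onto? : ∀ {m k} (s : Fin m → Fin k) → Dec (Onto s)
onto? s = all? λ a → any? λ i → s i ≟ a

proper? : ∀ {n k} {G : Graph n} → (∀ u v → Dec (Adj G u v)) →
          (f : Fin n → Fin k) → Dec (Proper G f)
proper? adj? f = all? λ u → all? λ v → adj? u v →-dec ¬? (f u ≟ f v)

edgeCompelling? : ∀ {n k} {G : Graph n} → (∀ u v → Dec (Adj G u v)) →
                  (c : ProperColoring G k) → Dec (EdgeCompelling c)
edgeCompelling? {n} {k} {G} adj? c =
  map′ (λ h (r , color-r) → h r color-r) (λ h r color-r → h (r , color-r))
       (∀-function? resp λ r → all? (λ a → color c (r a) ≟ a) →-dec
                               any? λ a → any? λ b → adj? (r a) (r b))
  where
  resp : ∀ {r r′ : Fin k → Fin n} → r ≗ r′ →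
         ((∀ a → color c (r a) ≡ a) → ∃[ a ] ∃[ b ] Adj G (r a) (r b)) →
         (∀ a → color c (r′ a) ≡ a) → ∃[ a ] ∃[ b ] Adj G (r′ a) (r′ b)
  resp r≗r′ h color-r′ =
    let a , b , adj = h (λ a → trans (cong (color c) (r≗r′ a)) (color-r′ a))
    in a , b , subst₂ (Adj G) (r≗r′ a) (r≗r′ b) adj

pathColoring : ∀ {n k} (f : Fin n → Fin k) {_ : True (onto? f)} {_ : True (proper? adjacent? f)} →
               ProperColoring (pathGraph n) k
pathColoring f {onto} {proper} =
  record { color = f ; nonempty = toWitness onto ; proper = toWitness proper }

decidedECColoring :
  ∀ {n k} (f : Fin n → Fin k) {onto : True (onto? f)} {proper : True (proper? adjacent? f)} →
  {_ : True (edgeCompelling? adjacent? (pathColoring f {onto} {proper}))} →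
  HasECColoring (pathGraph n) k
decidedECColoring f {onto} {proper} {ec} = pathColoring f {onto} {proper} , toWitness ec

P₂-coloring : HasECColoring (pathGraph 2) 2
P₂-coloring = decidedECColoring (# 0 ∷ # 1 ∷ [])

P₃-coloring : HasECColoring (pathGraph 3) 2
P₃-coloring = decidedECColoring (# 0 ∷ # 1 ∷ # 0 ∷ [])

P₄-coloring : HasECColoring (pathGraph 4) 3
P₄-coloring = decidedECColoring (# 0 ∷ # 1 ∷ # 2 ∷ # 0 ∷ [])

P₅-coloring : HasECColoring (pathGraph 5) 3
P₅-coloring = decidedECColoring (# 0 ∷ # 1 ∷ # 2 ∷ # 1 ∷ # 0 ∷ [])

P₆-coloring : HasECColoring (pathGraph 6) 3
P₆-coloring = decidedECColoring (# 0 ∷ # 1 ∷ # 0 ∷ # 1 ∷ # 2 ∷ # 0 ∷ [])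

alternate : ℕ → Fin 4
alternate 0             = # 0
alternate 1             = # 1
alternate (suc (suc i)) = alternate i

alternate-step : ∀ i → alternate i ≢ alternate (suc i)
alternate-step 0             = λ ()
alternate-step 1             = λ ()
alternate-step (suc (suc i)) = alternate-step i

alternate-binary : ∀ i → alternate i ≡ # 0 ⊎ alternate i ≡ # 1
alternate-binary 0             = inj₁ refl
alternate-binary 1             = inj₂ refl
alternate-binary (suc (suc i)) = alternate-binary i

stripe : ℕ → Fin 4
stripe 0             = # 2
stripe 1             = # 3
stripe (suc (suc i)) = alternate i

stripe-step : ∀ i → stripe i ≢ stripe (suc i)
stripe-step 0             = λ ()
stripe-step 1             = λ ()
stripe-step (suc (suc i)) = alternate-step i

stripe≡2⇒0 : ∀ i → stripe i ≡ # 2 → i ≡ 0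
stripe≡2⇒0 0 _ = refl
stripe≡2⇒0 1 ()
stripe≡2⇒0 (suc (suc i)) e with alternate-binary i
... | inj₁ eq = contradiction (trans (sym eq) e) λ ()
... | inj₂ eq = contradiction (trans (sym eq) e) λ ()

stripe≡3⇒1 : ∀ i → stripe i ≡ # 3 → i ≡ 1
stripe≡3⇒1 0 ()
stripe≡3⇒1 1 _ = refl
stripe≡3⇒1 (suc (suc i)) e with alternate-binary i
... | inj₁ eq = contradiction (trans (sym eq) e) λ ()
... | inj₂ eq = contradiction (trans (sym eq) e) λ ()

stripeColoring : ∀ q → ProperColoring (pathGraph (4 + q)) 4
stripeColoring q = record
  { color    = stripe ∘ toℕ
  ; nonempty = λ { zero → # 2 , refl ; (suc zero) → # 3 , refl
                 ; (suc (suc zero)) → # 0 , refl ; (suc (suc (suc zero))) → # 1 , refl }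
  ; proper   = λ { u v (inj₁ e) → subst (λ j → stripe (toℕ u) ≢ stripe j) (sym e)
                                          (stripe-step (toℕ u))
                 ; u v (inj₂ e) → subst (λ i → stripe i ≢ stripe (toℕ v)) (sym e)
                                          (stripe-step (toℕ v) ∘ sym) }
  }

stripeColoring-edgeCompelling : ∀ q → EdgeCompelling (stripeColoring q)
stripeColoring-edgeCompelling q =
  dominatingSingleton⇒edgeCompelling (stripeColoring q) {v = # 1} {a = # 2}
    (λ w e → toℕ-injective (stripe≡3⇒1 (toℕ w) e))
    (λ w e → inj₂ (cong suc (sym (stripe≡2⇒0 (toℕ w) e))))

fin2-neighbours : {a b c : Fin 2} → a ≢ b → c ≢ b → a ≡ c
fin2-neighbours {zero}     {_}        {zero}     _   _   = refl
fin2-neighbours {suc zero} {_}        {suc zero} _   _   = refl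
fin2-neighbours {zero}     {zero}     {suc zero} a≢b _   = contradiction refl a≢b
fin2-neighbours {zero}     {suc zero} {suc zero} _   c≢b = contradiction refl c≢b
fin2-neighbours {suc zero} {zero}     {zero}     _   c≢b = contradiction refl c≢b
fin2-neighbours {suc zero} {suc zero} {zero}     a≢b _   = contradiction refl a≢b

path-¬hasEC-two : ∀ q → ¬ HasECColoring (pathGraph (4 + q)) 2
path-¬hasEC-two q (c , ec) =
  independentTransversal⇒¬edgeCompelling c ends (from-yes (independent? adjacent? ends)) onto ec
  where
  ends : Fin 2 → Fin (4 + q)
  ends = # 0 ∷ # 3 ∷ []
  c₀≡c₂ : color c (# 0) ≡ color c (# 2)
  c₀≡c₂ = fin2-neighbours (proper c (# 0) (# 1) (inj₁ refl)) (proper c (# 2) (# 1) (inj₂ refl))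
  c₃≢c₀ : color c (# 3) ≢ color c (# 0)
  c₃≢c₀ e = proper c (# 2) (# 3) (inj₁ refl) (trans (sym c₀≡c₂) (sym e))
  onto : Onto (color c ∘ ends)
  onto a with a ≟ color c (# 0)
  ... | yes a≡c₀ = zero , sym a≡c₀
  ... | no  a≢c₀ = suc zero , sym (fin2-neighbours a≢c₀ c₃≢c₀)

-- A certificate, for a coloring f of the first seven vertices of a longer path, that no
-- extension of f is edge-compelling: an independent transversal inside the prefix, or a
-- color x absent from it that completes the colors of vertices 0 and 3 (the x-colored
-- vertex is then at distance at least 4 from vertex 3).
Obstruction : (Fin 7 → Fin 3) → Set
Obstruction f =
  (∃[ i ] ∃[ j ] ∃[ k ] Independent (pathGraph 7) (i ∷ j ∷ k ∷ []) × Onto (f ∘ (i ∷ j ∷ k ∷ [])))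
  ⊎ (∃[ x ] (∀ i → f i ≢ x) × Onto (f (# 0) ∷ f (# 3) ∷ x ∷ []))

obstruction? : ∀ f → Dec (Obstruction f)
obstruction? f =
  (any? λ i → any? λ j → any? λ k →
     independent? adjacent? (i ∷ j ∷ k ∷ []) ×-dec onto? (f ∘ (i ∷ j ∷ k ∷ [])))
  ⊎-dec (any? λ x → all? (λ i → ¬? (f i ≟ x)) ×-dec onto? (f (# 0) ∷ f (# 3) ∷ x ∷ []))

Proper-resp : ∀ {n k} {G : Graph n} {f g : Fin n → Fin k} → f ≗ g → Proper G f → Proper G g
Proper-resp f≗g proper-f u v adj e = proper-f u v adj (trans (f≗g u) (trans e (sym (f≗g v))))

Obstruction-resp : ∀ {f g} → f ≗ g → Obstruction f → Obstruction g
Obstruction-resp f≗g (inj₁ (i , j , k , independent , onto)) =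
  inj₁ (i , j , k , independent , Onto-resp (f≗g ∘ (i ∷ j ∷ k ∷ [])) onto)
Obstruction-resp {f} {g} f≗g (inj₂ (x , absent , onto)) =
  inj₂ (x , (λ i e → absent i (trans (f≗g i) e)) , Onto-resp ends onto)
  where
  ends : (f (# 0) ∷ f (# 3) ∷ x ∷ []) ≗ (g (# 0) ∷ g (# 3) ∷ x ∷ [])
  ends zero             = f≗g (# 0)
  ends (suc zero)       = f≗g (# 3)
  ends (suc (suc zero)) = refl

P₇-obstruction : ∀ f → Proper (pathGraph 7) f → Obstruction f
P₇-obstruction =
  from-yes (∀-function? (λ f≗g h → Obstruction-resp f≗g ∘ h ∘ Proper-resp (sym ∘ f≗g))
                        (λ f → proper? adjacent? f →-dec obstruction? f))

path-¬hasEC-three : ∀ q → ¬ HasECColoring (pathGraph (7 + q)) 3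
path-¬hasEC-three q (c , ec) = refute (P₇-obstruction prefix prefix-proper)
  where
  prefix : Fin 7 → Fin 3
  prefix = color c ∘ (_↑ˡ q)
  prefix-proper : Proper (pathGraph 7) prefix
  prefix-proper u v adj = proper c _ _ (↑ˡ-preserves-adjacency q adj)
  refute : ¬ Obstruction prefix
  refute (inj₁ (i , j , k , independent , onto)) =
    independentTransversal⇒¬edgeCompelling c ((_↑ˡ q) ∘ (i ∷ j ∷ k ∷ []))
      (λ a b → independent a b ∘ ↑ˡ-reflects-adjacency q) onto ec
  refute (inj₂ (x , absent , onto)) =
    independentTransversal⇒¬edgeCompelling c triple independent (Onto-resp colors onto) ec
    where
    w = proj₁ (nonempty c x)
    beyond : 7 ≤ toℕ w
    beyond = absentFromPrefix⇒beyond (color c) absent (proj₂ (nonempty c x))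
    triple : Fin 3 → Fin (7 + q)
    triple = # 0 ∷ # 3 ∷ w ∷ []
    colors : (prefix (# 0) ∷ prefix (# 3) ∷ x ∷ []) ≗ color c ∘ triple
    colors zero             = refl
    colors (suc zero)       = refl
    colors (suc (suc zero)) = sym (proj₂ (nonempty c x))
    far₀ : 2 + 0 ≤ toℕ w
    far₀ = m+n≤o⇒n≤o 5 beyond
    far₃ : 2 + 3 ≤ toℕ w
    far₃ = m+n≤o⇒n≤o 2 beyond
    independent : Independent (pathGraph (7 + q)) triple
    independent zero             zero             = path-irrefl {u = triple zero}
    independent zero             (suc zero)       = λ { (inj₁ ()) ; (inj₂ ()) }
    independent zero             (suc (suc zero)) = distant⇒¬adjacent far₀
    independent (suc zero)       zero             = λ { (inj₁ ()) ; (inj₂ ()) }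
    independent (suc zero)       (suc zero)       = path-irrefl {u = triple (suc zero)}
    independent (suc zero)       (suc (suc zero)) = distant⇒¬adjacent far₃
    independent (suc (suc zero)) zero             = distant⇒¬adjacent far₀ ∘ path-sym
    independent (suc (suc zero)) (suc zero)       = distant⇒¬adjacent far₃ ∘ path-sym
    independent (suc (suc zero)) (suc (suc zero)) = path-irrefl

path-¬hasEC-below-2 : ∀ q m → m < 2 → ¬ HasECColoring (pathGraph (2 + q)) m
path-¬hasEC-below-2 q =
  ¬hasEC-below-suc (¬hasEC-below-suc (λ _ ()) (¬coloring-zero ∘ proj₁))
                   (edge⇒¬coloring-one {u = zero} {v = suc zero} (inj₁ refl) ∘ proj₁)

path-¬hasEC-below-3 : ∀ q m → m < 3 → ¬ HasECColoring (pathGraph (4 + q)) m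
path-¬hasEC-below-3 q = ¬hasEC-below-suc (path-¬hasEC-below-2 (2 + q)) (path-¬hasEC-two q)

path-¬hasEC-below-4 : ∀ q m → m < 4 → ¬ HasECColoring (pathGraph (7 + q)) m
path-¬hasEC-below-4 q = ¬hasEC-below-suc (path-¬hasEC-below-3 (3 + q)) (path-¬hasEC-three q)

path≥7-ecChromaticNumber : ∀ q → ECChromaticNumber (pathGraph (7 + q)) 4
path≥7-ecChromaticNumber q =
  (stripeColoring (3 + q) , stripeColoring-edgeCompelling (3 + q)) , path-¬hasEC-below-4 q

mainTheorem6 : ECChromaticNumber (pathGraph 2) 2
    × ECChromaticNumber (pathGraph 3) 2
    × ECChromaticNumber (pathGraph 4) 3
    × ECChromaticNumber (pathGraph 5) 3
    × ECChromaticNumber (pathGraph 6) 3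
    × (∀ (n : ℕ) → 7 ≤ n → ECChromaticNumber (pathGraph n) 4)
mainTheorem6 =
    (P₂-coloring , path-¬hasEC-below-2 0)
  , (P₃-coloring , path-¬hasEC-below-2 1)
  , (P₄-coloring , path-¬hasEC-below-3 0)
  , (P₅-coloring , path-¬hasEC-below-3 1)
  , (P₆-coloring , path-¬hasEC-below-3 2)
  , λ n 7≤n → let q , 7+q≡n = m≤n⇒∃[o]m+o≡n 7≤n in
              subst (λ n → ECChromaticNumber (pathGraph n) 4) 7+q≡n (path≥7-ecChromaticNumber q)
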